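{- Every instance $A\vdash B$ of every axiom schema of $\mathbf{CNL_4^2}$ satisfies $A\vDash_{\mathbf{CNL_4^2}}B$, and each inference rule of $\mathbf{CNL_4^2}$ preserves this property: whenever every premise $X\vdash Y$ of an instance of a rule satisfies $X\vDash_{\mathbf{CNL_4^2}}Y$, so does its conclusion.
   Context: Formulas are built from a countable set $PV$ of variables with binary $\wedge,\vee$ and unary ${\sim}$; ${\sim}^{n}A$ denotes $n$-fold application of ${\sim}$. Semantics: $\mathscr U=\{\mathbf T,\mathbf{TU},\mathbf{FU},\mathbf F\}$ ordered as the lattice $4\mathcal Q$ with $\mathbf T$ top, $\mathbf F$ bottom, $\mathbf{TU},\mathbf{FU}$ incomparable; $f_{\sim}$: $\mathbf T\mapsto\mathbf{TU}$, $\mathbf{TU}\mapsto\mathbf F$, $\mathbf F\mapsto\mathbf{FU}$, $\mathbf{FU}\mapsto\mathbf T$; designated set $\mathcal D=\{\mathbf T,\mathbf{TU}\}$. A $\mathbf{CNL_4^2}$-valuation is a map $PV\to\mathscr U$ extended to formulas with $\wedge,\vee$ as meet/join in $4\mathcal Q$ and ${\sim}$ as $f_{\sim}$. $A\vDash_{\mathbf{CNL_4^2}}B$ means every $\mathbf{CNL_4^2}$-valuation designating $A$ designates $B$. The calculus $\mathbf{CNL_4^2}$ (on sequents $A\vdash B$) has axiom schemata (a1) $A\wedge B\vdash A$; (a2) $A\wedge B\vdash B$; (a3) $B\vdash A\vee B$; (a4) $A\vdash A\vee B$; (a5) $A\vdash{\sim}^{4}A$; (a6) ${\sim}^{4}A\vdash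 A$; (a7) ${\sim}A\wedge{\sim}B\vdash{\sim}(A\wedge B)$; (a8) ${\sim}(A\vee B)\vdash{\sim}A\vee{\sim}B$; (a9) $A\wedge{\sim}^{2}A\vdash B$; (a10) $A\wedge(B\vee C)\vdash(A\wedge B)\vee(A\wedge C)$; (b1) ${\sim}(A\wedge B)\vdash{\sim}A\wedge{\sim}B$; (b2) ${\sim}A\vee{\sim}B\vdash{\sim}(A\vee B)$; and rules (r1) $A\vdash B$, $B\vdash C$ / $A\vdash C$; (r2) $A\vdash B$, $A\vdash C$ / $A\vdash B\wedge C$; (r3) $A\vdash C$, $B\vdash C$ / $A\vee B\vdash C$; (r4) $A\vdash B$ / ${\sim}^{2}B\vdash{\sim}^{2}A$. -}

module Defs where

open import Data.Nat using (ℕ; zero; suc)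
open import Data.Product using (_×_)

data Formula : Set where
  var : ℕ → Formula
  _∧_ : Formula → Formula → Formula
  _∨_ : Formula → Formula → Formula
  ∼_  : Formula → Formula

infixr 6 _∧_
infixr 5 _∨_
infix 8 ∼_

∼^ : ℕ → Formula → Formula
∼^ zero    A = A
∼^ (suc n) A = ∼ (∼^ n A)

data V : Set where
  T TU FU F : V

-- meet in the lattice 4Q (T top, F bottom, TU and FU incomparable)
meet : V → V → V
meet T  y  = y
meet F  y  = F
meet TU T  = TU
meet TU TU = TU
meet TU FU = F
meet TU F  = F
meet FU T  = FU
meet FU TU = F
meet FU FU = FU
meet FU F  = F

join : V → V → V
join T  y  = T
join F  y  = y
join TU T  = T
join TU TU = TU
join TU FU = T
join TU F  = TU
join FU T  = T
join FU TU = T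
join FU FU = FU
join FU F  = FU

fneg : V → V
fneg T  = TU
fneg TU = F
fneg F  = FU
fneg FU = T

data Designated : V → Set where
  desT  : Designated T
  desTU : Designated TU

Valuation : Set
Valuation = ℕ → V

eval : Valuation → Formula → V
eval v (var p) = v p
eval v (A ∧ B) = meet (eval v A) (eval v B)
eval v (A ∨ B) = join (eval v A) (eval v B)
eval v (∼ A)   = fneg (eval v A)

_⊨_ : Formula → Formula → Set
A ⊨ B = (v : Valuation) → Designated (eval v A) → Designated (eval v B)

infix 2 _⊨_

-- Instances of the axiom schemata (a1)–(a10), (b1), (b2): Axiom A B means A ⊢ B is an axiom instance
data Axiom : Formula → Formula → Set where
  a1  : ∀ A B → Axiom (A ∧ B) A
  a2  : ∀ A B → Axiom (A ∧ B) B
  a3  : ∀ A B → Axiom B (A ∨ B)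
  a4  : ∀ A B → Axiom A (A ∨ B)
  a5  : ∀ A → Axiom A (∼^ 4 A)
  a6  : ∀ A → Axiom (∼^ 4 A) A
  a7  : ∀ A B → Axiom (∼ A ∧ ∼ B) (∼ (A ∧ B))
  a8  : ∀ A B → Axiom (∼ (A ∨ B)) (∼ A ∨ ∼ B)
  a9  : ∀ A B → Axiom (A ∧ ∼^ 2 A) B
  a10 : ∀ A B C → Axiom (A ∧ (B ∨ C)) ((A ∧ B) ∨ (A ∧ C))
  b1  : ∀ A B → Axiom (∼ (A ∧ B)) (∼ A ∧ ∼ B)
  b2  : ∀ A B → Axiom (∼ A ∨ ∼ B) (∼ (A ∨ B))

RulesPreserve : Set
RulesPreserve =
  (∀ A B C → (A ⊨ B) → (B ⊨ C) → (A ⊨ C))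
  × (∀ A B C → (A ⊨ B) → (A ⊨ C) → (A ⊨ B ∧ C))
  × (∀ A B C → (A ⊨ C) → (B ⊨ C) → (A ∨ B ⊨ C))
  × (∀ A B → (A ⊨ B) → (∼^ 2 B ⊨ ∼^ 2 A))

-- The designated set D = {T, TU} is the principal filter of the atom TU of the
-- four-element Boolean lattice 4Q, and its preimage under f_∼ is the principal
-- filter {T, FU} of the other atom. Principal filters of atoms are prime, so
-- designation commutes with ∧ and ∨ both before and after one negation; this gives
-- (a1)–(a4), (a7), (a8), (a10), (b1), (b2), (r2) and (r3). Moreover f_∼ has order 4,
-- giving (a5) and (a6), and f_∼² swaps D with its complement, giving (a9) and (r4).
module Submission where

open import Defs
open import Data.Empty using (⊥-elim)
open import Data.Product using (_×_; _,_; proj₁; proj₂)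
open import Data.Sum using (_⊎_; inj₁; inj₂)
open import Relation.Nullary using (¬_)
open import Relation.Binary.PropositionalEquality using (_≡_; refl; sym; subst)

record PrimeFilter (P : V → Set) : Set where
  field
    meet⁺ : ∀ x y → P x → P y → P (meet x y)
    meet⁻ : ∀ x y → P (meet x y) → P x × P y
    join⁺ : ∀ x y → P x ⊎ P y → P (join x y)
    join⁻ : ∀ x y → P (join x y) → P x ⊎ P y

  meet-distribˡ-join : ∀ x y z → P (meet x (join y z)) → P (join (meet x y) (meet x z))
  meet-distribˡ-join x y z d with meet⁻ x (join y z) d
  ... | px , pyz with join⁻ y z pyz
  ...   | inj₁ py = join⁺ (meet x y) (meet x z) (inj₁ (meet⁺ x y px py))
  ...   | inj₂ pz = join⁺ (meet x y) (meet x z) (inj₂ (meet⁺ x z px pz))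

designated-primeFilter : PrimeFilter Designated
designated-primeFilter = record
  { meet⁺ = meet⁺ ; meet⁻ = meet⁻ ; join⁺ = join⁺ ; join⁻ = join⁻ }
  where
  meet⁺ : ∀ x y → Designated x → Designated y → Designated (meet x y)
  meet⁺ T  y  _     dy    = dy
  meet⁺ TU T  desTU desT  = desTU
  meet⁺ TU TU desTU desTU = desTU

  meet⁻ : ∀ x y → Designated (meet x y) → Designated x × Designated y
  meet⁻ T  y  d  = desT , d
  meet⁻ TU T  _  = desTU , desT
  meet⁻ TU TU _  = desTU , desTU
  meet⁻ FU T  ()
  meet⁻ F  y  ()

  join⁺ : ∀ x y → Designated x ⊎ Designated y → Designated (join x y)
  join⁺ T  y  _          = desT
  join⁺ TU T  _          = desT
  join⁺ TU TU _          = desTU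
  join⁺ TU FU _          = desT
  join⁺ TU F  _          = desTU
  join⁺ FU T  _          = desT
  join⁺ FU TU _          = desT
  join⁺ FU FU (inj₁ ())
  join⁺ FU F  (inj₁ ())
  join⁺ F  y  (inj₂ dy)  = dy

  join⁻ : ∀ x y → Designated (join x y) → Designated x ⊎ Designated y
  join⁻ T  y  _  = inj₁ desT
  join⁻ TU y  _  = inj₁ desTU
  join⁻ FU T  _  = inj₂ desT
  join⁻ FU TU _  = inj₂ desTU
  join⁻ FU FU ()
  join⁻ F  y  d  = inj₂ d

NegDesignated : V → Set
NegDesignated x = Designated (fneg x)

negDesignated-primeFilter : PrimeFilter NegDesignated
negDesignated-primeFilter = record
  { meet⁺ = meet⁺ ; meet⁻ = meet⁻ ; join⁺ = join⁺ ; join⁻ = join⁻ }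
  where
  meet⁺ : ∀ x y → NegDesignated x → NegDesignated y → NegDesignated (meet x y)
  meet⁺ T  T  _ _ = desTU
  meet⁺ T  FU _ _ = desT
  meet⁺ FU T  _ _ = desT
  meet⁺ FU FU _ _ = desT

  meet⁻ : ∀ x y → NegDesignated (meet x y) → NegDesignated x × NegDesignated y
  meet⁻ T  T  _ = desTU , desTU
  meet⁻ T  FU _ = desTU , desT
  meet⁻ FU T  _ = desT , desTU
  meet⁻ FU FU _ = desT , desT
  meet⁻ T  TU ()
  meet⁻ T  F  ()
  meet⁻ TU T  ()
  meet⁻ TU TU ()
  meet⁻ TU FU ()
  meet⁻ TU F  ()
  meet⁻ FU TU ()
  meet⁻ FU F  ()
  meet⁻ F  y  ()

  join⁺ : ∀ x y → NegDesignated x ⊎ NegDesignated y → NegDesignated (join x y)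
  join⁺ T  y  _ = desTU
  join⁺ TU T  _ = desTU
  join⁺ TU FU _ = desTU
  join⁺ FU T  _ = desTU
  join⁺ FU TU _ = desTU
  join⁺ FU FU _ = desT
  join⁺ FU F  _ = desT
  join⁺ F  T  _ = desTU
  join⁺ F  FU _ = desT
  join⁺ TU TU (inj₁ ())
  join⁺ TU F  (inj₁ ())
  join⁺ F  TU (inj₁ ())
  join⁺ F  F  (inj₁ ())

  join⁻ : ∀ x y → NegDesignated (join x y) → NegDesignated x ⊎ NegDesignated y
  join⁻ T  y  _ = inj₁ desTU
  join⁻ FU y  _ = inj₁ desT
  join⁻ TU T  _ = inj₂ desTU
  join⁻ TU FU _ = inj₂ desT
  join⁻ F  T  _ = inj₂ desTU
  join⁻ F  FU _ = inj₂ desT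
  join⁻ TU TU ()
  join⁻ TU F  ()
  join⁻ F  TU ()
  join⁻ F  F  ()

fneg⁴≡id : ∀ x → fneg (fneg (fneg (fneg x))) ≡ x
fneg⁴≡id T  = refl
fneg⁴≡id TU = refl
fneg⁴≡id FU = refl
fneg⁴≡id F  = refl

designated-fneg²⁻ : ∀ x → Designated (fneg (fneg x)) → ¬ Designated x
designated-fneg²⁻ T  () _
designated-fneg²⁻ TU () _

designated-fneg²⁺ : ∀ x → ¬ Designated x → Designated (fneg (fneg x))
designated-fneg²⁺ T  nd = ⊥-elim (nd desT)
designated-fneg²⁺ TU nd = ⊥-elim (nd desTU)
designated-fneg²⁺ FU _  = desTU
designated-fneg²⁺ F  _  = desT

module D = PrimeFilter designated-primeFilter
module N = PrimeFilter negDesignated-primeFilter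

axiom-sound : ∀ A B → Axiom A B → A ⊨ B
axiom-sound _ _ (a1 A B) v d = proj₁ (D.meet⁻ (eval v A) (eval v B) d)
axiom-sound _ _ (a2 A B) v d = proj₂ (D.meet⁻ (eval v A) (eval v B) d)
axiom-sound _ _ (a3 A B) v d = D.join⁺ (eval v A) (eval v B) (inj₂ d)
axiom-sound _ _ (a4 A B) v d = D.join⁺ (eval v A) (eval v B) (inj₁ d)
axiom-sound _ _ (a5 A) v d = subst Designated (sym (fneg⁴≡id (eval v A))) d
axiom-sound _ _ (a6 A) v d = subst Designated (fneg⁴≡id (eval v A)) d
axiom-sound _ _ (a7 A B) v d =
  let a = eval v A ; b = eval v B ; (da , db) = D.meet⁻ (fneg a) (fneg b) d
  in N.meet⁺ a b da db
axiom-sound _ _ (a8 A B) v d =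
  D.join⁺ (fneg (eval v A)) (fneg (eval v B)) (N.join⁻ (eval v A) (eval v B) d)
axiom-sound _ _ (a9 A B) v d =
  let (da , d∼∼a) = D.meet⁻ (eval v A) (fneg (fneg (eval v A))) d
  in ⊥-elim (designated-fneg²⁻ (eval v A) d∼∼a da)
axiom-sound _ _ (a10 A B C) v = D.meet-distribˡ-join (eval v A) (eval v B) (eval v C)
axiom-sound _ _ (b1 A B) v d =
  let a = eval v A ; b = eval v B ; (da , db) = N.meet⁻ a b d
  in D.meet⁺ (fneg a) (fneg b) da db
axiom-sound _ _ (b2 A B) v d =
  N.join⁺ (eval v A) (eval v B) (D.join⁻ (fneg (eval v A)) (fneg (eval v B)) d)

rules-sound : RulesPreserve
rules-sound = r1 , r2 , r3 , r4
  where
  r1 : ∀ A B C → (A ⊨ B) → (B ⊨ C) → (A ⊨ C)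
  r1 _ _ _ A⊨B B⊨C v d = B⊨C v (A⊨B v d)

  r2 : ∀ A B C → (A ⊨ B) → (A ⊨ C) → (A ⊨ B ∧ C)
  r2 _ B C A⊨B A⊨C v d = D.meet⁺ (eval v B) (eval v C) (A⊨B v d) (A⊨C v d)

  r3 : ∀ A B C → (A ⊨ C) → (B ⊨ C) → (A ∨ B ⊨ C)
  r3 A B _ A⊨C B⊨C v d with D.join⁻ (eval v A) (eval v B) d
  ... | inj₁ da = A⊨C v da
  ... | inj₂ db = B⊨C v db

  r4 : ∀ A B → (A ⊨ B) → (∼^ 2 B ⊨ ∼^ 2 A)
  r4 A B A⊨B v d∼∼b =
    designated-fneg²⁺ (eval v A) (λ da → designated-fneg²⁻ (eval v B) d∼∼b (A⊨B v da))

mainTheorem4 : (∀ A B → Axiom A B → A ⊨ B) × RulesPreserve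
mainTheorem4 = axiom-sound , rules-sound
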